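{- Let $LIP(\mathbb Z)$ denote the set of LIP functions $\mathbb Z\to\mathbb Z$. Then: (1) if $f,g\in LIP(\mathbb Z)$ then the composition $x\mapsto f(g(x))$ is in $LIP(\mathbb Z)$; (2) if $f\in LIP(\mathbb Z)$ then the function $x\mapsto f(x)-f(x-1)$ is in $LIP(\mathbb Z)$.
   Context: A function $f\colon\mathbb Z\to\mathbb Z$ is LIP on $\mathbb Z$ if for every finite $X\subseteq\mathbb Z$ there is $p\in\mathbb Z[x]$ with $p(x)=f(x)$ for all $x\in X$. -}

module Defs where

open import Data.Integer using (ℤ; _+_; _*_; _-_; 0ℤ; 1ℤ)
open import Data.List using (List; []; _∷_)
open import Data.List.Membership.Propositional using (_∈_)
open import Data.Product using (Σ; ∃)
open import Relation.Binary.PropositionalEquality using (_≡_)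

-- A polynomial in ℤ[x], represented by its coefficient list
-- (constant term first): a₀ ∷ a₁ ∷ … ∷ aₙ ∷ [] stands for a₀ + a₁ x + … + aₙ xⁿ.
Poly : Set
Poly = List ℤ

eval : Poly → ℤ → ℤ
eval []       x = 0ℤ
eval (a ∷ as) x = a + x * eval as x

LIP : (ℤ → ℤ) → Set
LIP f = (X : List ℤ) → ∃ λ (p : Poly) → ∀ {x} → x ∈ X → eval p x ≡ f x

-- Polynomials are closed under composition and subtraction. An interpolant of f
-- on the image g[X] composed with an interpolant of g on X interpolates f ∘ g on X,
-- and the backward difference is f − f ∘ (x − 1), where x − 1 is itself a polynomial.
module Submission where

open import Data.Integer using (ℤ; _+_; _*_; _-_; 0ℤ; 1ℤ; -1ℤ)
open import Data.Integer.Properties using (+-identityˡ; +-identityʳ; *-zeroˡ; *-zeroʳ; *-identityʳ; +-comm; -1*i≡-i)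
open import Data.Integer.Tactic.RingSolver using (solve-∀)
open import Data.List using ([]; _∷_; map)
open import Data.List.Membership.Propositional.Properties using (∈-map⁺)
open import Data.Product using (_×_; _,_)
open import Function using (_∘_)
open import Relation.Binary.PropositionalEquality
  using (_≡_; _≗_; refl; sym; trans; cong; cong₂; module ≡-Reasoning)

open import Defs

open ≡-Reasoning

infixl 6 _+ᵖ_ _-ᵖ_
infixl 7 _·ᵖ_ _*ᵖ_
infixr 9 _∘ᵖ_

_+ᵖ_ : Poly → Poly → Poly
[]      +ᵖ q       = q
(a ∷ p) +ᵖ []      = a ∷ p
(a ∷ p) +ᵖ (b ∷ q) = (a + b) ∷ (p +ᵖ q)

_·ᵖ_ : ℤ → Poly → Poly
c ·ᵖ p = map (c *_) p

_-ᵖ_ : Poly → Poly → Poly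
p -ᵖ q = p +ᵖ -1ℤ ·ᵖ q

_*ᵖ_ : Poly → Poly → Poly
[]      *ᵖ q = []
(a ∷ p) *ᵖ q = a ·ᵖ q +ᵖ (0ℤ ∷ p *ᵖ q)

_∘ᵖ_ : Poly → Poly → Poly
[]      ∘ᵖ q = []
(a ∷ p) ∘ᵖ q = (a ∷ []) +ᵖ q *ᵖ (p ∘ᵖ q)

eval-+ᵖ : ∀ p q x → eval (p +ᵖ q) x ≡ eval p x + eval q x
eval-+ᵖ []      q       x = sym (+-identityˡ (eval q x))
eval-+ᵖ (a ∷ p) []      x = sym (+-identityʳ (a + x * eval p x))
eval-+ᵖ (a ∷ p) (b ∷ q) x = begin
  (a + b) + x * eval (p +ᵖ q) x       ≡⟨ cong (λ r → (a + b) + x * r) (eval-+ᵖ p q x) ⟩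
  (a + b) + x * (eval p x + eval q x) ≡⟨ regroup a b x (eval p x) (eval q x) ⟩
  (a + x * eval p x) + (b + x * eval q x) ∎
  where
  regroup : ∀ a b x u v → (a + b) + x * (u + v) ≡ (a + x * u) + (b + x * v)
  regroup = solve-∀

eval-·ᵖ : ∀ c p x → eval (c ·ᵖ p) x ≡ c * eval p x
eval-·ᵖ c []      x = sym (*-zeroʳ c)
eval-·ᵖ c (a ∷ p) x = begin
  c * a + x * eval (c ·ᵖ p) x ≡⟨ cong (λ r → c * a + x * r) (eval-·ᵖ c p x) ⟩
  c * a + x * (c * eval p x)  ≡⟨ factor c a x (eval p x) ⟩
  c * (a + x * eval p x)      ∎
  where
  factor : ∀ c a x u → c * a + x * (c * u) ≡ c * (a + x * u)
  factor = solve-∀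

eval--ᵖ : ∀ p q x → eval (p -ᵖ q) x ≡ eval p x - eval q x
eval--ᵖ p q x = begin
  eval (p +ᵖ -1ℤ ·ᵖ q) x          ≡⟨ eval-+ᵖ p (-1ℤ ·ᵖ q) x ⟩
  eval p x + eval (-1ℤ ·ᵖ q) x    ≡⟨ cong (eval p x +_) (eval-·ᵖ -1ℤ q x) ⟩
  eval p x + -1ℤ * eval q x       ≡⟨ cong (eval p x +_) (-1*i≡-i (eval q x)) ⟩
  eval p x - eval q x             ∎

eval-*ᵖ : ∀ p q x → eval (p *ᵖ q) x ≡ eval p x * eval q x
eval-*ᵖ []      q x = sym (*-zeroˡ (eval q x))
eval-*ᵖ (a ∷ p) q x = begin
  eval (a ·ᵖ q +ᵖ (0ℤ ∷ p *ᵖ q)) x                ≡⟨ eval-+ᵖ (a ·ᵖ q) (0ℤ ∷ p *ᵖ q) x ⟩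
  eval (a ·ᵖ q) x + (0ℤ + x * eval (p *ᵖ q) x)    ≡⟨ cong₂ (λ r s → r + (0ℤ + x * s)) (eval-·ᵖ a q x) (eval-*ᵖ p q x) ⟩
  a * eval q x + (0ℤ + x * (eval p x * eval q x)) ≡⟨ factor a x (eval p x) (eval q x) ⟩
  (a + x * eval p x) * eval q x                   ∎
  where
  factor : ∀ a x u v → a * v + (0ℤ + x * (u * v)) ≡ (a + x * u) * v
  factor = solve-∀

eval-constant : ∀ a x → eval (a ∷ []) x ≡ a
eval-constant a x = trans (cong (a +_) (*-zeroʳ x)) (+-identityʳ a)

eval-∘ᵖ : ∀ p q x → eval (p ∘ᵖ q) x ≡ eval p (eval q x)
eval-∘ᵖ []      q x = refl
eval-∘ᵖ (a ∷ p) q x = begin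
  eval ((a ∷ []) +ᵖ q *ᵖ (p ∘ᵖ q)) x          ≡⟨ eval-+ᵖ (a ∷ []) (q *ᵖ (p ∘ᵖ q)) x ⟩
  (a + x * 0ℤ) + eval (q *ᵖ (p ∘ᵖ q)) x       ≡⟨ cong ((a + x * 0ℤ) +_) (eval-*ᵖ q (p ∘ᵖ q) x) ⟩
  (a + x * 0ℤ) + eval q x * eval (p ∘ᵖ q) x   ≡⟨ cong (λ r → (a + x * 0ℤ) + eval q x * r) (eval-∘ᵖ p q x) ⟩
  (a + x * 0ℤ) + eval q x * eval p (eval q x) ≡⟨ cong (λ r → r + eval q x * eval p (eval q x)) (eval-constant a x) ⟩
  a + eval q x * eval p (eval q x)            ∎

predᵖ : Poly
predᵖ = -1ℤ ∷ 1ℤ ∷ []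

eval-predᵖ : ∀ x → eval predᵖ x ≡ x - 1ℤ
eval-predᵖ x = begin
  -1ℤ + x * eval (1ℤ ∷ []) x ≡⟨ cong (λ r → -1ℤ + x * r) (eval-constant 1ℤ x) ⟩
  -1ℤ + x * 1ℤ               ≡⟨ cong (-1ℤ +_) (*-identityʳ x) ⟩
  -1ℤ + x                    ≡⟨ +-comm -1ℤ x ⟩
  x - 1ℤ                     ∎

eval-LIP : ∀ p → LIP (eval p)
eval-LIP p X = p , λ _ → refl

LIP-resp-≗ : ∀ {f g} → f ≗ g → LIP f → LIP g
LIP-resp-≗ f≗g lip-f X with lip-f X
... | p , p≡f = p , λ {x} x∈X → trans (p≡f x∈X) (f≗g x)

LIP-∘ : ∀ {f g} → LIP f → LIP g → LIP (f ∘ g)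
LIP-∘ {f} {g} lip-f lip-g X with lip-g X | lip-f (map g X)
... | q , q≡g | p , p≡f = p ∘ᵖ q , λ {x} x∈X → begin
  eval (p ∘ᵖ q) x   ≡⟨ eval-∘ᵖ p q x ⟩
  eval p (eval q x) ≡⟨ cong (eval p) (q≡g x∈X) ⟩
  eval p (g x)      ≡⟨ p≡f (∈-map⁺ g x∈X) ⟩
  f (g x)           ∎

LIP-- : ∀ {f g} → LIP f → LIP g → LIP (λ x → f x - g x)
LIP-- {f} {g} lip-f lip-g X with lip-f X | lip-g X
... | p , p≡f | q , q≡g = p -ᵖ q , λ {x} x∈X →
  trans (eval--ᵖ p q x) (cong₂ _-_ (p≡f x∈X) (q≡g x∈X))

theorem5 : ((f g : ℤ → ℤ) → LIP f → LIP g → LIP (λ x → f (g x)))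
         × ((f : ℤ → ℤ) → LIP f → LIP (λ x → f x - f (x - 1ℤ)))
theorem5 = (λ f g → LIP-∘) , backward-difference
  where
  backward-difference : (f : ℤ → ℤ) → LIP f → LIP (λ x → f x - f (x - 1ℤ))
  backward-difference f lip-f =
    LIP-- lip-f (LIP-resp-≗ (cong f ∘ eval-predᵖ) (LIP-∘ lip-f (eval-LIP predᵖ)))
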